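{- Let $G\cong\mathbb{Z}/n\mathbb{Z}$ and write $n=d_1d_2\cdots d_k$ with primes $d_1\le d_2\le\cdots\le d_k$. Then the chromatic number of the power graph $\mathfrak{g}(G)$ is $$\chi(\mathfrak{g}(G))=\varphi(n)+\varphi\!\left(\tfrac{n}{d_1}\right)+\varphi\!\left(\tfrac{n}{d_1d_2}\right)+\cdots+\varphi\!\left(\tfrac{n}{d_1d_2\cdots d_k}\right).$$
   Context: The power graph $\mathfrak{g}(G)$ of a group $G$ has vertex set $G$, distinct $x,y$ adjacent iff $\langle x\rangle\le\langle y\rangle$ or $\langle y\rangle\le\langle x\rangle$. $\chi$ denotes chromatic number and $\varphi$ Euler's totient function. -}

module Defs where

open import Data.Nat using (ℕ; zero; suc; _+_; _*_; _≤_; NonZero)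
open import Data.Nat.DivMod using (_/_; _%_)
open import Data.Nat.GCD using (gcd)
open import Data.Nat.Properties using (_≟_)
open import Data.Fin using (Fin; toℕ)
open import Data.List using (List; length; filter; map; upTo)
open import Data.Product using (∃-syntax; Σ-syntax; _×_)
open import Data.Sum using (_⊎_)
open import Relation.Binary.PropositionalEquality using (_≡_; _≢_)

φ : ℕ → ℕ
φ n = length (filter (λ k → gcd k n ≟ 1) (map suc (upTo n)))

-- Total natural-number division (n /′ 0 = 0; only used with nonzero divisors).
_/′_ : ℕ → ℕ → ℕ
n /′ zero  = 0
n /′ suc m = n / suc m

-- The cyclic group ℤ/nℤ has carrier Fin n (residues 0,…,n-1) under addition mod n.
-- x ∈ ⟨ y ⟩ : x lies in the cyclic subgroup generated by y, i.e. x = k·y for some k.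
-- For cyclic subgroups, ⟨x⟩ ≤ ⟨y⟩ iff x ∈ ⟨y⟩.
_∈⟨_⟩ : {n : ℕ} .{{_ : NonZero n}} → Fin n → Fin n → Set
_∈⟨_⟩ {n} x y = ∃[ k ] (toℕ x ≡ (k * toℕ y) % n)

_⊑_ : {n : ℕ} .{{_ : NonZero n}} → Fin n → Fin n → Set
x ⊑ y = x ∈⟨ y ⟩

PowerAdj : (n : ℕ) .{{_ : NonZero n}} → Fin n → Fin n → Set
PowerAdj n x y = x ≢ y × (x ⊑ y ⊎ y ⊑ x)

Colourable : (n : ℕ) .{{_ : NonZero n}} → ℕ → Set
Colourable n c = Σ[ f ∈ (Fin n → Fin c) ] (∀ (x y : Fin n) → PowerAdj n x y → f x ≢ f y)

ChromaticNumber : (n : ℕ) .{{_ : NonZero n}} → ℕ → Set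
ChromaticNumber n m = Colourable n m × (∀ c → Colourable n c → m ≤ c)

-- Write N = d₁ ⋯ dₖ. A residue v has order o = N / gcd v N, and v / gcd v N is a unit modulo o.
-- If o has ℓ prime factors, v is coloured inside block k − ℓ, of size φ (d₍ₖ₋ₗ₊₁₎ ⋯ dₖ), by the
-- rank of its unit part among the units below o. This fits because among divisors with ℓ prime
-- factors φ is largest on the product of the ℓ largest primes, and it is proper because adjacent
-- residues either have equal orders and distinct unit parts, or orders one of which properly
-- divides the other and so has fewer prime factors. Conversely, for every prefix d₁ ⋯ dⱼ take the
-- φ (N / d₁ ⋯ dⱼ) generators of the subgroup of its multiples: along the chain of prefixes these
-- subgroups are nested, so all the generators together form a clique.

module Submission where

open import Defs
open import Data.Nat
open import Data.Nat.Properties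
open import Data.Nat.Divisibility
open import Data.Nat.DivMod
open import Data.Nat.GCD
open import Data.Nat.Coprimality as C using (Coprime; coprime?)
open import Data.Nat.Primality
open import Data.Nat.ListAction using (product; sum)
open import Data.Nat.Tactic.RingSolver using (solve-∀)
open import Algebra.Properties.CommutativeSemigroup *-commutativeSemigroup using (x∙yz≈y∙xz)
open import Data.Bool using (Bool; true; false; not; _∧_; if_then_else_)
open import Data.Bool.Properties using (∧-identityʳ; ∧-zeroʳ)
open import Data.Empty using (⊥-elim)
open import Data.Fin as Fin using (Fin; toℕ; fromℕ<)
open import Data.Fin.Properties using (injective⇒≤; toℕ<n; toℕ-fromℕ<; toℕ-injective)
open import Data.List as List using (List; []; _∷_; length; drop; map; filter; upTo; applyUpTo; inits; tails; concat)
open import Data.List.Properties using (map-applyUpTo; length-map; length-++; map-∘; map-cong)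
open import Data.List.Membership.Propositional using (_∈_)
open import Data.List.Membership.Propositional.Properties using (∈-lookup)
open import Data.List.Relation.Unary.Any using (here; there)
open import Data.List.Relation.Unary.All as All using (All; []; _∷_)
import Data.List.Relation.Unary.All.Properties as All
open import Data.List.Relation.Unary.AllPairs as AllPairs using (AllPairs; []; _∷_)
import Data.List.Relation.Unary.AllPairs.Properties as AllPairs
open import Data.List.Relation.Unary.Linked as Linked using ([]; [-]; _∷_)
open import Data.List.Relation.Unary.Linked.Properties using (Linked⇒All; Linked⇒AllPairs; AllPairs⇒Linked)
open import Data.List.Relation.Unary.Sorted.TotalOrder ≤-totalOrder using (Sorted)
open import Data.List.Relation.Binary.Equality.Propositional using (≋⇒≡)
open import Data.List.Relation.Binary.Pointwise using (Pointwise; []; _∷_)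
open import Data.List.Relation.Binary.Sublist.Propositional using (_⊆_; []; _∷_; _∷ʳ_)
open import Data.List.Relation.Binary.Sublist.Propositional.Properties using (All-resp-⊆; length-mono-≤; to-≋; drop-⊆)
open import Data.Product using (∃-syntax; _×_; _,_; proj₁)
open import Data.Sum using (inj₁; inj₂)
open import Function using (_∘_; id; _⇔_; mk⇔)
open import Relation.Binary using (tri<; tri≈; tri>)
open import Relation.Binary.PropositionalEquality
open import Relation.Nullary using (¬_; yes; no; does; ¬?; _×-dec_)
open import Relation.Nullary.Decidable using (dec-true; dec-false; does-⇔)
open import Relation.Unary using (Pred; Decidable)

-- Counting

indicator : Bool → ℕ
indicator true  = 1
indicator false = 0

count : (ℕ → Bool) → ℕ → ℕ
count P zero    = 0
count P (suc n) = indicator (P 0) + count (P ∘ suc) n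

length-filter-applyUpTo : ∀ {a p} {A : Set a} {Q : Pred A p} (Q? : Decidable Q) (f : ℕ → A) n →
  length (filter Q? (applyUpTo f n)) ≡ count (λ i → does (Q? (f i))) n
length-filter-applyUpTo Q? f zero = refl
length-filter-applyUpTo Q? f (suc n) with does (Q? (f 0))
... | true  = cong suc (length-filter-applyUpTo Q? (f ∘ suc) n)
... | false = length-filter-applyUpTo Q? (f ∘ suc) n

count-+ : ∀ P m n → count P (m + n) ≡ count P m + count (λ i → P (m + i)) n
count-+ P zero    n = refl
count-+ P (suc m) n = trans (cong (indicator (P 0) +_) (count-+ (P ∘ suc) m n))
  (sym (+-assoc (indicator (P 0)) _ _))

count-cong : ∀ P Q n → (∀ i → i < n → P i ≡ Q i) → count P n ≡ count Q n
count-cong P Q zero    P≡Q = refl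
count-cong P Q (suc n) P≡Q = cong₂ _+_ (cong indicator (P≡Q 0 z<s))
  (count-cong (P ∘ suc) (Q ∘ suc) n (λ i i<n → P≡Q (suc i) (s<s i<n)))

count-sucʳ : ∀ P n → count P (suc n) ≡ count P n + indicator (P n)
count-sucʳ P n = begin
  count P (suc n)                             ≡⟨ cong (count P) (+-comm 1 n) ⟩
  count P (n + 1)                             ≡⟨ count-+ P n 1 ⟩
  count P n + (indicator (P (n + 0)) + 0)     ≡⟨ cong (λ k → count P n + (indicator (P k) + 0)) (+-identityʳ n) ⟩
  count P n + (indicator (P n) + 0)           ≡⟨ cong (count P n +_) (+-identityʳ _) ⟩
  count P n + indicator (P n)                 ∎
  where open ≡-Reasoning

count-none : ∀ P n → (∀ i → i < n → P i ≡ false) → count P n ≡ 0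
count-none P zero    _  = refl
count-none P (suc n) P≡false rewrite P≡false 0 z<s =
  count-none (P ∘ suc) n (λ i i<n → P≡false (suc i) (s<s i<n))

count-periodic : ∀ P m → (∀ i → P (m + i) ≡ P i) → ∀ a → count P (a * m) ≡ a * count P m
count-periodic P m periodic zero    = refl
count-periodic P m periodic (suc a) = trans (count-+ P m (a * m))
  (cong (count P m +_) (trans (count-cong _ P (a * m) (λ i _ → periodic i)) (count-periodic P m periodic a)))

count-partition : ∀ P Q n → count P n ≡ count (λ i → P i ∧ Q i) n + count (λ i → P i ∧ not (Q i)) n
count-partition P Q zero = refl
count-partition P Q (suc n) with P 0 | Q 0 | count-partition (P ∘ suc) (Q ∘ suc) n
... | true  | true  | ih = cong suc ih
... | true  | false | ih = trans (cong suc ih) (sym (+-suc _ _))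
... | false | true  | ih = ih
... | false | false | ih = ih

count-monoʳ-≤ : ∀ P {m n} → m ≤ n → count P m ≤ count P n
count-monoʳ-≤ P {m} {n} m≤n = begin
  count P m                                ≤⟨ m≤m+n _ _ ⟩
  count P m + count (λ i → P (m + i)) (n ∸ m) ≡⟨ count-+ P m (n ∸ m) ⟨
  count P (m + (n ∸ m))                    ≡⟨ cong (count P) (m+[n∸m]≡n m≤n) ⟩
  count P n                                ∎
  where open ≤-Reasoning

count-monoʳ-< : ∀ P {u n} → P u ≡ true → u < n → count P u < count P n
count-monoʳ-< P {u} {n} Pu u<n = begin-strict
  count P u                  <⟨ n<1+n _ ⟩
  suc (count P u)            ≡⟨ +-comm 1 _ ⟩
  count P u + indicator true ≡⟨ cong (λ b → count P u + indicator b) Pu ⟨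
  count P u + indicator (P u) ≡⟨ count-sucʳ P u ⟨
  count P (suc u)            ≤⟨ count-monoʳ-≤ P u<n ⟩
  count P n                  ∎
  where open ≤-Reasoning

count-injective : ∀ P {u v} → P u ≡ true → P v ≡ true → count P u ≡ count P v → u ≡ v
count-injective P {u} {v} Pu Pv same with <-cmp u v
... | tri< u<v _ _ = ⊥-elim (<-irrefl same (count-monoʳ-< P Pu u<v))
... | tri≈ _ u≡v _ = u≡v
... | tri> _ _ v<u = ⊥-elim (<-irrefl (sym same) (count-monoʳ-< P Pv v<u))

-- Euler's totient

coprimeᵇ : ℕ → ℕ → Bool
coprimeᵇ m u = does (coprime? u m)

_∣ᵇ_ : ℕ → ℕ → Bool
p ∣ᵇ u = does (p ∣? u)

coprimeᵇ-cong : ∀ {m m′ u u′} → Coprime u m ⇔ Coprime u′ m′ → coprimeᵇ m u ≡ coprimeᵇ m′ u′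
coprimeᵇ-cong {m} {m′} {u} {u′} iff = does-⇔ iff (coprime? u m) (coprime? u′ m′)

coprime-*ʳ : ∀ {u a b} → Coprime u a → Coprime u b → Coprime u (a * b)
coprime-*ʳ {u} {a} ua ub {d} (d∣u , d∣ab) = ub (d∣u , C.coprime-divisor da d∣ab)
  where
  da : Coprime d a
  da (e∣d , e∣a) = ua (∣-trans e∣d d∣u , e∣a)

coprime-∣ʳ : ∀ {u a b} → Coprime u b → a ∣ b → Coprime u a
coprime-∣ʳ ub a∣b (d∣u , d∣a) = ub (d∣u , ∣-trans d∣a a∣b)

prime∤⇒coprime : ∀ {p u} → Prime p → ¬ p ∣ u → Coprime u p
prime∤⇒coprime pp p∤u (d∣u , d∣p) with prime⇒irreducible pp d∣p
... | inj₁ d≡1 = d≡1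
... | inj₂ refl = ⊥-elim (p∤u d∣u)

prime≢1 : ∀ {p} → Prime p → p ≢ 1
prime≢1 pp refl = ¬prime[1] pp

coprimeᵇ-periodic : ∀ m i → coprimeᵇ m (m + i) ≡ coprimeᵇ m i
coprimeᵇ-periodic m i = coprimeᵇ-cong {m} {m} {m + i} {i} (mk⇔
  (λ c {_} (d∣i , d∣m) → c (∣m∣n⇒∣m+n d∣m d∣i , d∣m))
  (λ c {_} (d∣m+i , d∣m) → c (∣m+n∣m⇒∣n d∣m+i d∣m , d∣m)))

-- φ counts 1,…,m; shifting to 0,…,m-1 trades m for 0, which is coprime to m just as well.
φ≡count-coprimeᵇ : ∀ m → φ m ≡ count (coprimeᵇ m) m
φ≡count-coprimeᵇ m = begin
  φ m                                  ≡⟨ cong (length ∘ filter (λ k → gcd k m ≟ 1)) (map-applyUpTo id suc m) ⟩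
  length (filter (λ k → gcd k m ≟ 1) (applyUpTo suc m))
                                       ≡⟨ length-filter-applyUpTo (λ k → gcd k m ≟ 1) suc m ⟩
  count (λ i → does (gcd (suc i) m ≟ 1)) m
                                       ≡⟨ count-cong _ _ m (λ i _ → gcd≟1≡coprimeᵇ (suc i)) ⟩
  count (coprimeᵇ m ∘ suc) m           ≡⟨ +-cancelˡ-≡ (indicator (coprimeᵇ m 0)) _ _ shift ⟩
  count (coprimeᵇ m) m                 ∎
  where
  open ≡-Reasoning
  gcd≟1≡coprimeᵇ : ∀ k → does (gcd k m ≟ 1) ≡ coprimeᵇ m k
  gcd≟1≡coprimeᵇ k = does-⇔ (mk⇔ C.gcd≡1⇒coprime C.coprime⇒gcd≡1) (gcd k m ≟ 1) (coprime? k m)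
  shift : count (coprimeᵇ m) (suc m) ≡ indicator (coprimeᵇ m 0) + count (coprimeᵇ m) m
  shift = begin
    count (coprimeᵇ m) (suc m)                            ≡⟨ count-sucʳ (coprimeᵇ m) m ⟩
    count (coprimeᵇ m) m + indicator (coprimeᵇ m m)       ≡⟨ cong (λ k → count (coprimeᵇ m) m + indicator (coprimeᵇ m k)) (+-identityʳ m) ⟨
    count (coprimeᵇ m) m + indicator (coprimeᵇ m (m + 0)) ≡⟨ cong (λ b → count (coprimeᵇ m) m + indicator b) (coprimeᵇ-periodic m 0) ⟩
    count (coprimeᵇ m) m + indicator (coprimeᵇ m 0)       ≡⟨ +-comm (count (coprimeᵇ m) m) _ ⟩
    indicator (coprimeᵇ m 0) + count (coprimeᵇ m) m       ∎

count-coprimeᵇ-* : ∀ a m → count (coprimeᵇ m) (a * m) ≡ a * φ m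
count-coprimeᵇ-* a m = trans (count-periodic (coprimeᵇ m) m (coprimeᵇ-periodic m) a)
  (cong (a *_) (sym (φ≡count-coprimeᵇ m)))

count-multiples : ∀ p .{{_ : NonZero p}} R (Q : ℕ → Bool) →
  count (λ u → Q u ∧ p ∣ᵇ u) (p * R) ≡ count (Q ∘ (p *_)) R
count-multiples p zero Q = cong (count _) (*-zeroʳ p)
count-multiples p@(suc p′) (suc R) Q = begin
  count F (p * suc R)                               ≡⟨ cong (count F) (*-suc p R) ⟩
  count F (p + p * R)                               ≡⟨ count-+ F p (p * R) ⟩
  count F p + count (λ i → F (p + i)) (p * R)       ≡⟨ cong₂ _+_ firstPeriod (count-cong _ _ (p * R) (λ i _ → cong (Q (p + i) ∧_) (∣ᵇ-periodic i))) ⟩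
  indicator (Q 0) + count (λ u → Q (p + u) ∧ p ∣ᵇ u) (p * R)
                                                    ≡⟨ cong₂ _+_ (cong (indicator ∘ Q) (sym (*-zeroʳ p))) (count-multiples p R (λ u → Q (p + u))) ⟩
  indicator (Q (p * 0)) + count (λ w → Q (p + p * w)) R
                                                    ≡⟨ cong (indicator (Q (p * 0)) +_) (count-cong _ _ R (λ w _ → cong Q (*-suc p w))) ⟨
  count (Q ∘ (p *_)) (suc R)                        ∎
  where
  open ≡-Reasoning
  F : ℕ → Bool
  F u = Q u ∧ p ∣ᵇ u
  ∣ᵇ-periodic : ∀ i → p ∣ᵇ (p + i) ≡ p ∣ᵇ i
  ∣ᵇ-periodic i = does-⇔ (mk⇔ (λ d → ∣m+n∣m⇒∣n d ∣-refl) (∣m∣n⇒∣m+n ∣-refl)) (p ∣? (p + i)) (p ∣? i)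
  firstPeriod : count F p ≡ indicator (Q 0)
  firstPeriod rewrite dec-true (p ∣? 0) (p ∣0) | ∧-identityʳ (Q 0)
    | count-none (F ∘ suc) p′ (λ i i<p′ → trans (cong (Q (suc i) ∧_) (dec-false (p ∣? suc i) (<⇒≱ (s<s i<p′) ∘ ∣⇒≤))) (∧-zeroʳ _))
    = +-identityʳ _

φ-*-∣ : ∀ {p} R → Prime p → p ∣ R → φ (p * R) ≡ p * φ R
φ-*-∣ {p} R pp p∣R = begin
  φ (p * R)                       ≡⟨ φ≡count-coprimeᵇ (p * R) ⟩
  count (coprimeᵇ (p * R)) (p * R) ≡⟨ count-cong _ _ (p * R) (λ u _ → coprimeᵇ-cong {p * R} {R} {u} {u} unit⇔unit) ⟩
  count (coprimeᵇ R) (p * R)      ≡⟨ count-coprimeᵇ-* p R ⟩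
  p * φ R                         ∎
  where
  open ≡-Reasoning
  unit⇔unit : ∀ {u} → Coprime u (p * R) ⇔ Coprime u R
  unit⇔unit {u} = mk⇔ shrink grow
    where
    shrink : Coprime u (p * R) → Coprime u R
    shrink c = coprime-∣ʳ c (∣n⇒∣m*n p ∣-refl)
    grow : Coprime u R → Coprime u (p * R)
    grow c = coprime-*ʳ (coprime-∣ʳ c p∣R) c

coprimeᵇ-*ˡ : ∀ {a m} → Coprime a m → ∀ w → coprimeᵇ m (a * w) ≡ coprimeᵇ m w
coprimeᵇ-*ˡ {a} {m} am w = coprimeᵇ-cong {m} {m} {a * w} {w} (mk⇔ shrink grow)
  where
  shrink : Coprime (a * w) m → Coprime w m
  shrink c = C.sym (coprime-∣ʳ (C.sym c) (∣n⇒∣m*n a ∣-refl))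
  grow : Coprime w m → Coprime (a * w) m
  grow c = C.sym (coprime-*ʳ (C.sym am) (C.sym c))

-- Among 0,…,pR-1 the residues coprime to R number p·φ(R); those also divisible by p are p·w with w coprime to R.
φ-*-∤ : ∀ {p} R → Prime p → ¬ p ∣ R → φ (p * R) ≡ (p ∸ 1) * φ R
φ-*-∤ {p} R pp p∤R = begin
  φ (p * R)                        ≡⟨ φ≡count-coprimeᵇ (p * R) ⟩
  count (coprimeᵇ (p * R)) (p * R) ≡⟨ count-cong _ _ (p * R) (λ u _ → unit⇔unit∧∤ u) ⟩
  coprimeNonMultiples              ≡⟨ m+n∸m≡n coprimeMultiples coprimeNonMultiples ⟨
  (coprimeMultiples + coprimeNonMultiples) ∸ coprimeMultiples
                                   ≡⟨ cong₂ _∸_ partition (sym coprimeMultiples≡φ) ⟨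
  p * φ R ∸ 1 * φ R                ≡⟨ *-distribʳ-∸ (φ R) p 1 ⟨
  (p ∸ 1) * φ R                    ∎
  where
  open ≡-Reasoning
  instance _ = prime⇒nonZero pp
  coprimeMultiples coprimeNonMultiples : ℕ
  coprimeMultiples    = count (λ u → coprimeᵇ R u ∧ p ∣ᵇ u) (p * R)
  coprimeNonMultiples = count (λ u → coprimeᵇ R u ∧ not (p ∣ᵇ u)) (p * R)
  unit⇔unit∧∤ : ∀ u → coprimeᵇ (p * R) u ≡ coprimeᵇ R u ∧ not (p ∣ᵇ u)
  unit⇔unit∧∤ u = does-⇔ (mk⇔ split join) (coprime? u (p * R)) (coprime? u R ×-dec ¬? (p ∣? u))
    where
    split : Coprime u (p * R) → Coprime u R × ¬ p ∣ u
    split c = coprime-∣ʳ c (∣n⇒∣m*n p ∣-refl) , λ p∣u → prime≢1 pp (c (p∣u , m∣m*n R))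
    join : Coprime u R × ¬ p ∣ u → Coprime u (p * R)
    join (c , p∤u) = coprime-*ʳ (prime∤⇒coprime pp p∤u) c
  partition : p * φ R ≡ coprimeMultiples + coprimeNonMultiples
  partition = trans (sym (count-coprimeᵇ-* p R)) (count-partition (coprimeᵇ R) (p ∣ᵇ_) (p * R))
  coprimeMultiples≡φ : coprimeMultiples ≡ 1 * φ R
  coprimeMultiples≡φ = begin
    coprimeMultiples               ≡⟨ count-multiples p R (coprimeᵇ R) ⟩
    count (coprimeᵇ R ∘ (p *_)) R  ≡⟨ count-cong _ _ R (λ w _ → coprimeᵇ-*ˡ (C.sym (prime∤⇒coprime pp p∤R)) w) ⟩
    count (coprimeᵇ R) R           ≡⟨ φ≡count-coprimeᵇ R ⟨
    φ R                            ≡⟨ *-identityˡ (φ R) ⟨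
    1 * φ R                        ∎

-- φ of a product of sorted primes

AllPairs-resp-⊆ : ∀ {a r} {A : Set a} {R : A → A → Set r} {xs ys} → xs ⊆ ys → AllPairs R ys → AllPairs R xs
AllPairs-resp-⊆ []         []           = []
AllPairs-resp-⊆ (_ ∷ʳ τ)   (_ ∷ Rys)    = AllPairs-resp-⊆ τ Rys
AllPairs-resp-⊆ (refl ∷ τ) (Ry ∷ Rys)   = All-resp-⊆ τ Ry ∷ AllPairs-resp-⊆ τ Rys

Sorted-resp-⊆ : ∀ {xs ys} → xs ⊆ ys → Sorted ys → Sorted xs
Sorted-resp-⊆ τ = AllPairs⇒Linked ∘ AllPairs-resp-⊆ τ ∘ Linked⇒AllPairs ≤-trans

pointwise-∷-drop : ∀ {x ys} k xs → All (x ≤_) xs → k < length xs →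
  Pointwise _≤_ ys (drop (suc k) xs) → Pointwise _≤_ (x ∷ ys) (drop k xs)
pointwise-∷-drop zero    (z ∷ zs) (x≤z ∷ _)   _         ys≤zs = x≤z ∷ ys≤zs
pointwise-∷-drop (suc k) (z ∷ zs) (_ ∷ x≤zs) (s<s k<n) ys≤zs = pointwise-∷-drop k zs x≤zs k<n ys≤zs

⊆-sorted⇒≤-suffix : ∀ {ys xs} → ys ⊆ xs → Sorted xs →
  Pointwise _≤_ ys (drop (length xs ∸ length ys) xs)
⊆-sorted⇒≤-suffix []                       _  = []
⊆-sorted⇒≤-suffix (_ ∷ʳ τ) sorted
  rewrite +-∸-assoc 1 (length-mono-≤ τ) = ⊆-sorted⇒≤-suffix τ (Linked.tail sorted)
⊆-sorted⇒≤-suffix {x ∷ ys} {x ∷ xs} (refl ∷ τ) sorted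
  with length xs ∸ length ys | m∸n≤m (length xs) (length ys) | ⊆-sorted⇒≤-suffix τ (Linked.tail sorted)
... | zero  | _   | ys≤xs = ≤-refl ∷ ys≤xs
... | suc k | k<n | ys≤xs = pointwise-∷-drop k xs (All.tail (Linked⇒All ≤-trans ≤-refl sorted)) k<n ys≤xs

-- For sorted primes, φ (p₁ ⋯ pₖ) is the product of pᵢ − 1 over first occurrences and of pᵢ over repetitions.
totientFactor : ℕ → ℕ → ℕ
totientFactor q x = if does (q ≟ x) then x else x ∸ 1

totientAfter : ℕ → List ℕ → ℕ
totientAfter q []       = 1
totientAfter q (x ∷ xs) = totientFactor q x * totientAfter x xs

totientFactor-≡ : ∀ q → totientFactor q q ≡ q
totientFactor-≡ q rewrite dec-true (q ≟ q) refl = refl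

totientFactor-≢ : ∀ {q x} → q ≢ x → totientFactor q x ≡ x ∸ 1
totientFactor-≢ {q} {x} q≢x rewrite dec-false (q ≟ x) q≢x = refl

totientFactor-≤ : ∀ q x → totientFactor q x ≤ x
totientFactor-≤ q x with does (q ≟ x)
... | true  = ≤-refl
... | false = m∸n≤m x 1

∸1≤totientFactor : ∀ q x → x ∸ 1 ≤ totientFactor q x
∸1≤totientFactor q x with does (q ≟ x)
... | true  = m∸n≤m x 1
... | false = ≤-refl

totientFactor-mono-≤ : ∀ {q r a b} → a ≤ b → q ≤ r → r ≤ b → totientFactor q a ≤ totientFactor r b
totientFactor-mono-≤ {q} {r} {a} {b} a≤b q≤r r≤b with a ≟ b
... | no a≢b = begin
  totientFactor q a ≤⟨ totientFactor-≤ q a ⟩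
  a                 ≤⟨ suc[m]≤n⇒m≤pred[n] (≤∧≢⇒< a≤b a≢b) ⟩
  pred b            ≡⟨ pred[m∸n]≡m∸[1+n] b 0 ⟩
  b ∸ 1             ≤⟨ ∸1≤totientFactor r b ⟩
  totientFactor r b ∎
  where open ≤-Reasoning
... | yes refl with r ≟ a
...   | yes refl = ≤-trans (totientFactor-≤ q r) (≤-reflexive (sym (totientFactor-≡ r)))
...   | no r≢a   = ≤-reflexive (trans (totientFactor-≢ (<⇒≢ (≤-<-trans q≤r (≤∧≢⇒< r≤b r≢a))))
                                      (sym (totientFactor-≢ r≢a)))

totientAfter-mono-≤ : ∀ {q r xs ys} → q ≤ r → Sorted (r ∷ ys) → Pointwise _≤_ xs ys →
  totientAfter q xs ≤ totientAfter r ys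
totientAfter-mono-≤ q≤r _ [] = ≤-refl
totientAfter-mono-≤ {ys = y ∷ ys} q≤r (r≤y ∷ sorted) (x≤y ∷ xs≤ys) =
  *-mono-≤ (totientFactor-mono-≤ x≤y q≤r r≤y) (totientAfter-mono-≤ x≤y sorted xs≤ys)

prime∣product⇒∈ : ∀ {q ps} → Prime q → All Prime ps → q ∣ product ps → q ∈ ps
prime∣product⇒∈ {ps = []}     pq _          q∣1 = ⊥-elim (prime≢1 pq (∣1⇒≡1 q∣1))
prime∣product⇒∈ {ps = p ∷ ps} pq (pp ∷ pps) q∣pP with euclidsLemma p (product ps) pq q∣pP
... | inj₂ q∣P = there (prime∣product⇒∈ pq pps q∣P)
... | inj₁ q∣p with prime⇒irreducible pp q∣p
...   | inj₁ q≡1  = ⊥-elim (prime≢1 pq q≡1)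
...   | inj₂ refl = here refl

φ-*-sorted : ∀ {q} ps → Prime q → All Prime ps → Sorted (q ∷ ps) →
  φ (q * product ps) ≡ (q ∸ 1) * totientAfter q ps
φ-*-sorted {q} [] pq _ _ = φ-*-∤ 1 pq (prime≢1 pq ∘ ∣1⇒≡1)
φ-*-sorted {q} (x ∷ xs) pq (px ∷ pxs) (q≤x ∷ sorted) with q ≟ x
... | yes refl = begin
  φ (q * (q * product xs))          ≡⟨ φ-*-∣ (q * product xs) pq (m∣m*n (product xs)) ⟩
  q * φ (q * product xs)            ≡⟨ cong (q *_) (φ-*-sorted xs pq pxs sorted) ⟩
  q * ((q ∸ 1) * totientAfter q xs) ≡⟨ x∙yz≈y∙xz q (q ∸ 1) _ ⟩
  (q ∸ 1) * (q * totientAfter q xs) ≡⟨ cong (λ t → (q ∸ 1) * (t * totientAfter q xs)) (totientFactor-≡ q) ⟨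
  (q ∸ 1) * totientAfter q (q ∷ xs) ∎
  where open ≡-Reasoning
... | no q≢x = begin
  φ (q * (x * product xs))          ≡⟨ φ-*-∤ (x * product xs) pq q∤xP ⟩
  (q ∸ 1) * φ (x * product xs)      ≡⟨ cong ((q ∸ 1) *_) (φ-*-sorted xs px pxs sorted) ⟩
  (q ∸ 1) * ((x ∸ 1) * totientAfter x xs)
                                    ≡⟨ cong (λ t → (q ∸ 1) * (t * totientAfter x xs)) (totientFactor-≢ q≢x) ⟨
  (q ∸ 1) * totientAfter q (x ∷ xs) ∎
  where
  open ≡-Reasoning
  q<all : All (q <_) (x ∷ xs)
  q<all = All.map (<-≤-trans (≤∧≢⇒< q≤x q≢x)) (Linked⇒All ≤-trans ≤-refl sorted)
  q∤xP : ¬ q ∣ x * product xs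
  q∤xP q∣xP = <-irrefl refl (All.lookup q<all (prime∣product⇒∈ pq (px ∷ pxs) q∣xP))

φ-product-sorted : ∀ ps → All Prime ps → Sorted ps → φ (product ps) ≡ totientAfter 0 ps
φ-product-sorted []       _          _      = refl
φ-product-sorted (p ∷ ps) (pp ∷ pps) sorted = trans (φ-*-sorted ps pp pps sorted)
  (cong (_* totientAfter p ps) (sym (totientFactor-≢ (λ 0≡p → ¬prime[0] (subst Prime (sym 0≡p) pp)))))

-- Prime factors of a divisor

divisorFactors : List ℕ → ℕ → List ℕ
divisorFactors []       o = []
divisorFactors (p ∷ ps) o with p ∣? o
... | yes p∣o = p ∷ divisorFactors ps (quotient p∣o)
... | no  _   = divisorFactors ps o

divisorFactors-⊆ : ∀ ps o → divisorFactors ps o ⊆ ps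
divisorFactors-⊆ []       o = []
divisorFactors-⊆ (p ∷ ps) o with p ∣? o
... | yes p∣o = refl ∷ divisorFactors-⊆ ps (quotient p∣o)
... | no  _   = p ∷ʳ divisorFactors-⊆ ps o

quotient-∣-cancelˡ : ∀ {p o n} .{{_ : NonZero p}} (p∣o : p ∣ o) → o ∣ p * n → quotient p∣o ∣ n
quotient-∣-cancelˡ {p} {o} {n} p∣o o∣pn = *-cancelʳ-∣ p
  (subst₂ _∣_ (m∣n⇒n≡quotient*m p∣o) (*-comm p n) o∣pn)

quotient-∣-mono : ∀ {p o o′} .{{_ : NonZero p}} (p∣o : p ∣ o) (p∣o′ : p ∣ o′) → o ∣ o′ →
  quotient p∣o ∣ quotient p∣o′
quotient-∣-mono {p} p∣o p∣o′ o∣o′ = *-cancelʳ-∣ p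
  (subst₂ _∣_ (m∣n⇒n≡quotient*m p∣o) (m∣n⇒n≡quotient*m p∣o′) o∣o′)

prime∤⇒∣-cancelˡ : ∀ {p o n} → Prime p → ¬ p ∣ o → o ∣ p * n → o ∣ n
prime∤⇒∣-cancelˡ pp p∤o = C.coprime-divisor (prime∤⇒coprime pp p∤o)

product-divisorFactors : ∀ {ps o} → All Prime ps → o ∣ product ps → product (divisorFactors ps o) ≡ o
product-divisorFactors {[]}     _          o∣1 = sym (∣1⇒≡1 o∣1)
product-divisorFactors {p ∷ ps} {o} (pp ∷ pps) o∣pP with p ∣? o
... | yes p∣o = begin
  p * product (divisorFactors ps (quotient p∣o)) ≡⟨ cong (p *_) (product-divisorFactors pps (quotient-∣-cancelˡ p∣o o∣pP)) ⟩
  p * quotient p∣o                               ≡⟨ *-comm p _ ⟩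
  quotient p∣o * p                               ≡⟨ m∣n⇒n≡quotient*m p∣o ⟨
  o                                              ∎
  where
  open ≡-Reasoning
  instance _ = prime⇒nonZero pp
... | no p∤o = product-divisorFactors pps (prime∤⇒∣-cancelˡ pp p∤o o∣pP)

divisorFactors-mono : ∀ {ps o o′} → All Prime ps → o ∣ o′ → o′ ∣ product ps →
  divisorFactors ps o ⊆ divisorFactors ps o′
divisorFactors-mono {[]} _ _ _ = []
divisorFactors-mono {p ∷ ps} {o} {o′} (pp ∷ pps) o∣o′ o′∣pP with p ∣? o | p ∣? o′
... | yes p∣o | yes p∣o′ = refl ∷ divisorFactors-mono pps (quotient-∣-mono p∣o p∣o′ o∣o′) (quotient-∣-cancelˡ p∣o′ o′∣pP)
  where instance _ = prime⇒nonZero pp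
... | yes p∣o | no p∤o′  = ⊥-elim (p∤o′ (∣-trans p∣o o∣o′))
... | no p∤o  | yes p∣o′ = p ∷ʳ divisorFactors-mono pps o∣o′/p (quotient-∣-cancelˡ p∣o′ o′∣pP)
  where
  instance _ = prime⇒nonZero pp
  o∣o′/p : o ∣ quotient p∣o′
  o∣o′/p = prime∤⇒∣-cancelˡ pp p∤o (subst (o ∣_) (trans (m∣n⇒n≡quotient*m p∣o′) (*-comm _ p)) o∣o′)
... | no p∤o  | no p∤o′  = divisorFactors-mono pps o∣o′ (prime∤⇒∣-cancelˡ pp p∤o′ o′∣pP)

length-divisorFactors-mono-< : ∀ {ps o o′} → All Prime ps → o ∣ o′ → o′ ∣ product ps → o ≢ o′ →
  length (divisorFactors ps o) < length (divisorFactors ps o′)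
length-divisorFactors-mono-< {ps} {o} {o′} pps o∣o′ o′∣P o≢o′ = ≤∧≢⇒< (length-mono-≤ τ) (o≢o′ ∘ sameLength⇒≡)
  where
  τ : divisorFactors ps o ⊆ divisorFactors ps o′
  τ = divisorFactors-mono pps o∣o′ o′∣P
  sameLength⇒≡ : length (divisorFactors ps o) ≡ length (divisorFactors ps o′) → o ≡ o′
  sameLength⇒≡ same = begin
    o                                ≡⟨ product-divisorFactors pps (∣-trans o∣o′ o′∣P) ⟨
    product (divisorFactors ps o)    ≡⟨ cong product (≋⇒≡ (to-≋ same τ)) ⟩
    product (divisorFactors ps o′)   ≡⟨ product-divisorFactors pps o′∣P ⟩
    o′                               ∎
    where open ≡-Reasoning

0∷-sorted : ∀ {xs} → Sorted xs → Sorted (0 ∷ xs)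
0∷-sorted []               = [-]
0∷-sorted [-]              = z≤n ∷ [-]
0∷-sorted (x≤y ∷ sorted)   = z≤n ∷ x≤y ∷ sorted

φ-divisor-≤ : ∀ {ps o} → All Prime ps → Sorted ps → o ∣ product ps →
  φ o ≤ φ (product (drop (length ps ∸ length (divisorFactors ps o)) ps))
φ-divisor-≤ {ps} {o} pps sorted o∣P = begin
  φ o                         ≡⟨ cong φ (product-divisorFactors pps o∣P) ⟨
  φ (product F)               ≡⟨ φ-product-sorted F (All-resp-⊆ F⊆ps pps) (Sorted-resp-⊆ F⊆ps sorted) ⟩
  totientAfter 0 F            ≤⟨ totientAfter-mono-≤ z≤n (0∷-sorted (Sorted-resp-⊆ (drop-⊆ j ps) sorted))
                                   (⊆-sorted⇒≤-suffix F⊆ps sorted) ⟩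
  totientAfter 0 (drop j ps)  ≡⟨ φ-product-sorted (drop j ps) (All-resp-⊆ (drop-⊆ j ps) pps) (Sorted-resp-⊆ (drop-⊆ j ps) sorted) ⟨
  φ (product (drop j ps))     ∎
  where
  open ≤-Reasoning
  F : List ℕ
  F = divisorFactors ps o
  F⊆ps : F ⊆ ps
  F⊆ps = divisorFactors-⊆ ps o
  j : ℕ
  j = length ps ∸ length F

-- The colouring

offset : List ℕ → ℕ → ℕ
offset ps zero    = 0
offset ps (suc j) = offset ps j + φ (product (drop j ps))

offset-mono-≤ : ∀ ps {i j} → i ≤ j → offset ps i ≤ offset ps j
offset-mono-≤ ps {j = zero}  z≤n   = ≤-refl
offset-mono-≤ ps {i} {suc j} i≤1+j with m≤n⇒m<n∨m≡n i≤1+j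
... | inj₁ i<1+j = ≤-trans (offset-mono-≤ ps (s≤s⁻¹ i<1+j)) (m≤m+n _ _)
... | inj₂ refl  = ≤-refl

offset-∷ : ∀ p ps j → offset (p ∷ ps) (suc j) ≡ φ (p * product ps) + offset ps j
offset-∷ p ps zero    = +-comm 0 _
offset-∷ p ps (suc j) = trans (cong (_+ φ (product (drop j ps))) (offset-∷ p ps j))
  (+-assoc (φ (p * product ps)) _ _)

sum-φ-tails : ∀ ps → sum (map (φ ∘ product) (tails ps)) ≡ offset ps (suc (length ps))
sum-φ-tails []       = refl
sum-φ-tails (p ∷ ps) = trans (cong (φ (p * product ps) +_) (sum-φ-tails ps)) (sym (offset-∷ p ps (suc (length ps))))

a*m/′a*1≡m : ∀ a .{{_ : NonZero a}} m → (a * m) /′ (a * 1) ≡ m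
a*m/′a*1≡m a@(suc n) m rewrite *-identityʳ n | *-comm a m = m*n/n≡m m a

quotients-inits : ∀ a .{{_ : NonZero a}} {ps} → All NonZero ps →
  map (λ p → (a * product ps) /′ (a * product p)) (inits ps) ≡ map product (tails ps)
quotients-inits a {[]}     []          = cong (_∷ []) (a*m/′a*1≡m a 1)
quotients-inits a {p ∷ ps} (p≢0 ∷ ps≢0) = cong₂ _∷_ (a*m/′a*1≡m a (p * product ps)) (begin
  map (λ q → (a * (p * product ps)) /′ (a * product q)) (map (p ∷_) (inits ps))
    ≡⟨ map-∘ (inits ps) ⟨
  map (λ q → (a * (p * product ps)) /′ (a * (p * product q))) (inits ps)
    ≡⟨ map-cong (λ q → cong₂ _/′_ (sym (*-assoc a p (product ps))) (sym (*-assoc a p (product q)))) (inits ps) ⟩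
  map (λ q → ((a * p) * product ps) /′ ((a * p) * product q)) (inits ps)
    ≡⟨ quotients-inits (a * p) {{m*n≢0 a p}} ps≢0 ⟩
  map product (tails ps) ∎)
  where
  open ≡-Reasoning
  instance _ = p≢0

sum-φ-quotients-inits : ∀ {ps} → All NonZero ps →
  sum (map (λ p → φ (product ps /′ product p)) (inits ps)) ≡ offset ps (suc (length ps))
sum-φ-quotients-inits {ps} ps≢0 = begin
  sum (map (λ p → φ (product ps /′ product p)) (inits ps))
    ≡⟨ cong sum (map-cong (λ p → cong₂ (λ m d → φ (m /′ d)) (sym (*-identityˡ (product ps))) (sym (*-identityˡ (product p)))) (inits ps)) ⟩
  sum (map (λ p → φ ((1 * product ps) /′ (1 * product p))) (inits ps))
    ≡⟨ cong sum (map-∘ (inits ps)) ⟩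
  sum (map φ (map (λ p → (1 * product ps) /′ (1 * product p)) (inits ps)))
    ≡⟨ cong (sum ∘ map φ) (quotients-inits 1 ps≢0) ⟩
  sum (map φ (map product (tails ps)))
    ≡⟨ cong sum (map-∘ (tails ps)) ⟨
  sum (map (φ ∘ product) (tails ps))
    ≡⟨ sum-φ-tails ps ⟩
  offset ps (suc (length ps)) ∎
  where open ≡-Reasoning

∣m∣n⇒∣m%n : ∀ {d m n} .{{_ : NonZero n}} → d ∣ m → d ∣ n → d ∣ m % n
∣m∣n⇒∣m%n {d} {m} {n} d∣m d∣n = ∣m+n∣m⇒∣n
  (subst (d ∣_) (trans (m≡m%n+[m/n]*n m n) (+-comm (m % n) _)) d∣m) (∣n⇒∣m*n (m / n) d∣n)

module Residues (N : ℕ) .{{_ : NonZero N}} where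

  gcd≢0 : ∀ v → NonZero (gcd v N)
  gcd≢0 v = ≢-nonZero (gcd[m,n]≢0 v N (inj₂ (≢-nonZero⁻¹ N)))

  order : ℕ → ℕ
  order v = N / gcd v N
    where instance _ = gcd≢0 v

  unit : ℕ → ℕ
  unit v = v / gcd v N
    where instance _ = gcd≢0 v

  order*gcd≡N : ∀ v → order v * gcd v N ≡ N
  order*gcd≡N v = m/n*n≡m (gcd[m,n]∣n v N)
    where instance _ = gcd≢0 v

  unit*gcd≡v : ∀ v → unit v * gcd v N ≡ v
  unit*gcd≡v v = m/n*n≡m (gcd[m,n]∣m v N)
    where instance _ = gcd≢0 v

  order≢0 : ∀ v → NonZero (order v)
  order≢0 v = ≢-nonZero λ order≡0 → ≢-nonZero⁻¹ N (trans (sym (order*gcd≡N v)) (cong (_* gcd v N) order≡0))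

  order∣N : ∀ v → order v ∣ N
  order∣N v = m/n∣m (gcd[m,n]∣n v N)
    where instance _ = gcd≢0 v

  unit<order : ∀ {v} → v < N → unit v < order v
  unit<order {v} v<N = *-cancelʳ-< (gcd v N) (unit v) (order v)
    (subst₂ _<_ (sym (unit*gcd≡v v)) (sym (order*gcd≡N v)) v<N)
    where instance _ = gcd≢0 v

  coprime-unit-order : ∀ v → Coprime (unit v) (order v)
  coprime-unit-order v = C.coprime-/gcd v N
    where instance _ = gcd≢0 v

  order-∣-multiple : ∀ {v w} t → v ≡ (t * w) % N → order v ∣ order w
  order-∣-multiple {v} {w} t v≡tw = m*n∣o⇒m∣o/n (order v) (gcd w N) (begin
    order v * gcd w N ∣⟨ *-monoʳ-∣ (order v) gcd[w]∣gcd[v] ⟩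
    order v * gcd v N ≡⟨ order*gcd≡N v ⟩
    N                 ∎)
    where
    open ∣-Reasoning
    instance _ = gcd≢0 w
    gcd[w]∣gcd[v] : gcd w N ∣ gcd v N
    gcd[w]∣gcd[v] = gcd-greatest
      (subst (gcd w N ∣_) (sym v≡tw) (∣m∣n⇒∣m%n (∣n⇒∣m*n t (gcd[m,n]∣m w N)) (gcd[m,n]∣n w N)))
      (gcd[m,n]∣n w N)

  order-unit-injective : ∀ {v w} → order v ≡ order w → unit v ≡ unit w → v ≡ w
  order-unit-injective {v} {w} same-order same-unit = begin
    v                   ≡⟨ unit*gcd≡v v ⟨
    unit v * gcd v N    ≡⟨ cong₂ _*_ same-unit same-gcd ⟩
    unit w * gcd w N    ≡⟨ unit*gcd≡v w ⟩
    w                   ∎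
    where
    open ≡-Reasoning
    same-gcd : gcd v N ≡ gcd w N
    same-gcd = *-cancelˡ-≡ _ _ (order v) {{order≢0 v}} (trans (order*gcd≡N v)
      (trans (sym (order*gcd≡N w)) (cong (_* gcd w N) (sym same-order))))

module Colouring (ps : List ℕ) (pps : All Prime ps) (sorted : Sorted ps) where

  N : ℕ
  N = product ps

  instance
    N≢0 : NonZero N
    N≢0 = productOfPrimes≢0 pps

  open Residues N

  Ω : ℕ → ℕ
  Ω v = length (divisorFactors ps (order v))

  level : ℕ → ℕ
  level v = length ps ∸ Ω v

  rank : ℕ → ℕ
  rank v = count (coprimeᵇ (order v)) (unit v)

  colour : ℕ → ℕ
  colour v = offset ps (level v) + rank v

  unit-coprimeᵇ : ∀ v → coprimeᵇ (order v) (unit v) ≡ true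
  unit-coprimeᵇ v = dec-true (C.coprime? (unit v) (order v)) (coprime-unit-order v)

  rank<φ : ∀ {v} → v < N → rank v < φ (order v)
  rank<φ {v} v<N = subst (rank v <_) (sym (φ≡count-coprimeᵇ (order v)))
    (count-monoʳ-< (coprimeᵇ (order v)) (unit-coprimeᵇ v) (unit<order v<N))

  colour<offset-next : ∀ {v} → v < N → colour v < offset ps (suc (level v))
  colour<offset-next {v} v<N = +-monoʳ-< (offset ps (level v))
    (≤-trans (rank<φ v<N) (φ-divisor-≤ pps sorted (order∣N v)))

  colour<total : ∀ {v} → v < N → colour v < offset ps (suc (length ps))
  colour<total {v} v<N = <-≤-trans (colour<offset-next v<N) (offset-mono-≤ ps (s≤s (m∸n≤m (length ps) (Ω v))))

  -- Equal orders give the same block, where the unit parts are told apart by rank; otherwise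
  -- the order of v properly divides that of w, so w has more prime factors and a lower block.
  colour-injective-on-multiples : ∀ {v w} t → v < N → w < N → v ≡ (t * w) % N → colour v ≡ colour w → v ≡ w
  colour-injective-on-multiples {v} {w} t v<N w<N v≡tw same with order v ≟ order w
  ... | yes same-order = order-unit-injective same-order
    (count-injective (coprimeᵇ (order w)) (subst (λ o → coprimeᵇ o (unit v) ≡ true) same-order (unit-coprimeᵇ v))
      (unit-coprimeᵇ w) same-rank)
    where
    same-rank : count (coprimeᵇ (order w)) (unit v) ≡ rank w
    same-rank = +-cancelˡ-≡ (offset ps (level w)) _ _
      (subst (λ o → offset ps (length ps ∸ length (divisorFactors ps o)) + count (coprimeᵇ o) (unit v) ≡ colour w)
        same-order same)
  ... | no order≢ = ⊥-elim (<-irrefl (sym same) (begin-strict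
    colour w                        <⟨ colour<offset-next w<N ⟩
    offset ps (suc (level w))       ≤⟨ offset-mono-≤ ps (∸-monoʳ-< Ωv<Ωw (length-mono-≤ (divisorFactors-⊆ ps (order w)))) ⟩
    offset ps (level v)             ≤⟨ m≤m+n _ _ ⟩
    colour v                        ∎))
    where
    open ≤-Reasoning
    Ωv<Ωw : Ω v < Ω w
    Ωv<Ωw = length-divisorFactors-mono-< pps (order-∣-multiple t v≡tw) (order∣N w) order≢

  colourable : Colourable N (sum (map (λ p → φ (N /′ product p)) (inits ps)))
  colourable = subst (Colourable N) (sym (sum-φ-quotients-inits (All.map prime⇒nonZero pps))) (colouring , proper)
    where
    colouring : Fin N → Fin (offset ps (suc (length ps)))
    colouring x = fromℕ< (colour<total (toℕ<n x))
    toℕ-colouring : ∀ x → toℕ (colouring x) ≡ colour (toℕ x)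
    toℕ-colouring x = toℕ-fromℕ< (colour<total (toℕ<n x))
    same-colour : ∀ x y → colouring x ≡ colouring y → colour (toℕ x) ≡ colour (toℕ y)
    same-colour x y eq = trans (sym (toℕ-colouring x)) (trans (cong toℕ eq) (toℕ-colouring y))
    proper : ∀ x y → PowerAdj N x y → colouring x ≢ colouring y
    proper x y (x≢y , inj₁ (t , x≡ty)) eq = x≢y (toℕ-injective
      (colour-injective-on-multiples t (toℕ<n x) (toℕ<n y) x≡ty (same-colour x y eq)))
    proper x y (x≢y , inj₂ (t , y≡tx)) eq = x≢y (sym (toℕ-injective
      (colour-injective-on-multiples t (toℕ<n y) (toℕ<n x) y≡tx (same-colour y x (sym eq)))))

-- The clique

AllPairs-≢⇒length≤ : ∀ {a} {A : Set a} {c} (f : A → Fin c) {xs} →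
  AllPairs (λ x y → f x ≢ f y) xs → length xs ≤ c
AllPairs-≢⇒length≤ f {xs} distinct = injective⇒≤ (lookup-injective distinct)
  where
  lookup-injective : ∀ {xs} → AllPairs (λ x y → f x ≢ f y) xs →
    ∀ {i j} → f (List.lookup xs i) ≡ f (List.lookup xs j) → i ≡ j
  lookup-injective (_  ∷ _)       {Fin.zero}  {Fin.zero}  _  = refl
  lookup-injective (fx≢ ∷ _)      {Fin.zero}  {Fin.suc j} eq = ⊥-elim (All.lookup fx≢ (∈-lookup j) eq)
  lookup-injective (fx≢ ∷ _)      {Fin.suc i} {Fin.zero}  eq = ⊥-elim (All.lookup fx≢ (∈-lookup i) (sym eq))
  lookup-injective (_  ∷ pairs)   {Fin.suc i} {Fin.suc j} eq = cong Fin.suc (lookup-injective pairs eq)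

AllPairs-zip-All : ∀ {a p r} {A : Set a} {P : A → Set p} {R : A → A → Set r} {xs} →
  All P xs → AllPairs R xs → AllPairs (λ x y → P x × P y × R x y) xs
AllPairs-zip-All []         []           = []
AllPairs-zip-All (px ∷ pxs) (Rx ∷ Rxs)   = All.zipWith (λ (py , r) → px , py , r) (pxs , Rx) ∷ AllPairs-zip-All pxs Rxs

modular-inverse : ∀ {u M} .{{_ : NonZero M}} → Coprime u M → ∃[ α ] (α * u) % M ≡ 1 % M
modular-inverse {u} {M@(suc c)} cop with C.coprime-Bézout cop
... | Bézout.+- x y 1+yM≡xu = x , (begin
  (x * u) % M         ≡⟨ cong (_% M) 1+yM≡xu ⟨
  (1 + y * M) % M     ≡⟨ [m+kn]%n≡m%n 1 y M ⟩
  1 % M               ∎)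
  where open ≡-Reasoning
... | Bézout.-+ x y 1+xu≡yM = c * x , (begin
  (c * x * u) % M                    ≡⟨ [m+kn]%n≡m%n (c * x * u) y M ⟨
  (c * x * u + y * M) % M            ≡⟨ cong (λ k → (c * x * u + k) % M) 1+xu≡yM ⟨
  (c * x * u + (1 + x * u)) % M      ≡⟨ cong (_% M) (regroup c x u) ⟩
  (1 + x * u * M) % M                ≡⟨ [m+kn]%n≡m%n 1 (x * u) M ⟩
  1 % M                              ∎)
  where
  open ≡-Reasoning
  regroup : ∀ c x u → c * x * u + (1 + x * u) ≡ 1 + x * u * suc c
  regroup = solve-∀

multiple-of-generator : ∀ {N} .{{_ : NonZero N}} G M {u y} → M * G ≡ N → Coprime u M → y < N → G ∣ y →
  ∃[ t ] y ≡ (t * (G * u)) % N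
multiple-of-generator G M {u} {y} refl cop y<MG (divides w y≡wG) with modular-inverse cop
  where instance _ = m*n≢0⇒m≢0 M
... | α , αu≡1 = w * α , (begin
  y                              ≡⟨ y≡wG ⟩
  w * G                          ≡⟨ cong (_* G) (m<n⇒m%n≡m w<M) ⟨
  (w % M) * G                    ≡⟨ cong (_* G) (w*αu%M≡w%M) ⟨
  ((w * (α * u)) % M) * G        ≡⟨ m%n*o≡m*o%[n*o] (w * (α * u)) M G ⟩
  (w * (α * u) * G) % (M * G)    ≡⟨ cong (_% (M * G)) (regroup w α u G) ⟩
  (w * α * (G * u)) % (M * G)    ∎)
  where
  open ≡-Reasoning
  instance _ = m*n≢0⇒m≢0 M
  w<M : w < M
  w<M = *-cancelʳ-< G w M (subst (_< M * G) y≡wG y<MG)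
  w*αu%M≡w%M : (w * (α * u)) % M ≡ w % M
  w*αu%M≡w%M = begin
    (w * (α * u)) % M              ≡⟨ %-distribˡ-* w (α * u) M ⟩
    ((w % M) * ((α * u) % M)) % M  ≡⟨ cong (λ k → ((w % M) * k) % M) αu≡1 ⟩
    ((w % M) * (1 % M)) % M        ≡⟨ %-distribˡ-* w 1 M ⟨
    (w * 1) % M                    ≡⟨ cong (_% M) (*-identityʳ w) ⟩
    w % M                          ∎
  regroup : ∀ w α u G → w * (α * u) * G ≡ w * α * (G * u)
  regroup = solve-∀

length-concat : ∀ {a} {A : Set a} (xss : List (List A)) → length (concat xss) ≡ sum (map length xss)
length-concat []         = refl
length-concat (xs ∷ xss) = trans (length-++ xs) (cong (length xs +_) (length-concat xss))

inits-∣ : ∀ ps → All (λ p → product p ∣ product ps) (inits ps)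
inits-∣ []       = ∣-refl ∷ []
inits-∣ (x ∷ xs) = 1∣ _ ∷ All.map⁺ (All.map (*-monoʳ-∣ x) (inits-∣ xs))

inits-strictly-∣ : ∀ {ps} → All Prime ps →
  AllPairs (λ p q → product p ∣ product q × product p ≢ product q) (inits ps)
inits-strictly-∣ []         = [] ∷ []
inits-strictly-∣ {x ∷ xs} (px ∷ pxs) =
  All.map⁺ (All.tabulate (λ {q} _ → 1∣ _ , λ 1≡xQ → prime≢1 px (m*n≡1⇒m≡1 x (product q) (sym 1≡xQ))))
  ∷ AllPairs.map⁺ (AllPairs.map (λ {p} {q} (p∣q , p≢q) →
      *-monoʳ-∣ x p∣q , p≢q ∘ *-cancelˡ-≡ (product p) (product q) x)
      (inits-strictly-∣ pxs))
  where instance _ = prime⇒nonZero px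

m/′n*n≡m : ∀ {m n} .{{_ : NonZero m}} → n ∣ m → (m /′ n) * n ≡ m
m/′n*n≡m {m} {zero}  0∣m = ⊥-elim (≢-nonZero⁻¹ m (0∣⇒≡0 0∣m))
m/′n*n≡m {m} {suc _} n∣m = m/n*n≡m n∣m

module Clique (ps : List ℕ) (pps : All Prime ps) where

  N : ℕ
  N = product ps

  instance
    N≢0 : NonZero N
    N≢0 = productOfPrimes≢0 pps

  Generates : ℕ → Fin N → Set
  Generates G x = gcd (toℕ x) N ≡ G × (∀ y → G ∣ toℕ y → y ⊑ x)

  generators-adjacent : ∀ {G G′ x y} → Generates G x → Generates G′ y → G ∣ G′ → x ≢ y → PowerAdj N x y
  generators-adjacent {G′ = G′} {y = y} (_ , generates) (gcd≡G′ , _) G∣G′ x≢y =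
    x≢y , inj₂ (generates y (∣-trans G∣G′ (subst (_∣ toℕ y) gcd≡G′ (gcd[m,n]∣m (toℕ y) N))))

  units : ℕ → List ℕ
  units M = filter (λ u → coprime? u M) (upTo M)

  block : ℕ → List (Fin N)
  block G = map (λ u → (G * u) mod N) (units (N /′ G))

  length-block : ∀ G → length (block G) ≡ φ (N /′ G)
  length-block G = begin
    length (block G)                 ≡⟨ length-map _ (units M) ⟩
    length (units M)                 ≡⟨ length-filter-applyUpTo (λ u → coprime? u M) id M ⟩
    count (coprimeᵇ M) M             ≡⟨ φ≡count-coprimeᵇ M ⟨
    φ M                              ∎
    where
    open ≡-Reasoning
    M : ℕ
    M = N /′ G

  module _ {G} (G∣N : G ∣ N) where

    private
      M : ℕ
      M = N /′ G

    M*G≡N : M * G ≡ N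
    M*G≡N = m/′n*n≡m G∣N

    private instance
      G≢0 : NonZero G
      G≢0 = m*n≢0⇒n≢0 M {{subst NonZero (sym M*G≡N) N≢0}}

    units-bounded-coprime : All (λ u → u < M × Coprime u M) (units M)
    units-bounded-coprime = All.zip (All.filter⁺ (λ u → coprime? u M) (All.applyUpTo⁺₁ id M id) , All.all-filter (λ u → coprime? u M) (upTo M))

    toℕ-mod-block : ∀ {u} → u < M → toℕ ((G * u) mod N) ≡ G * u
    toℕ-mod-block {u} u<M = trans (toℕ-fromℕ< (m%n<n (G * u) N)) (m<n⇒m%n≡m (begin-strict
      G * u   <⟨ *-monoʳ-< G u<M ⟩
      G * M   ≡⟨ *-comm G M ⟩
      M * G   ≡⟨ M*G≡N ⟩
      N       ∎))
      where open ≤-Reasoning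

    block-generates : All (Generates G) (block G)
    block-generates = All.map⁺ (All.map generator units-bounded-coprime)
      where
      generator : ∀ {u} → u < M × Coprime u M → Generates G ((G * u) mod N)
      generator {u} (u<M , cop) = gcd≡G , λ y G∣y →
        let t , y≡tGu = multiple-of-generator G M M*G≡N cop (toℕ<n y) G∣y
        in t , trans y≡tGu (cong (λ k → (t * k) % N) (sym (toℕ-mod-block u<M)))
        where
        gcd≡G : gcd (toℕ ((G * u) mod N)) N ≡ G
        gcd≡G = begin
          gcd (toℕ ((G * u) mod N)) N ≡⟨ cong₂ gcd (toℕ-mod-block u<M) (trans (sym M*G≡N) (*-comm M G)) ⟩
          gcd (G * u) (G * M)         ≡⟨ c*gcd[m,n]≡gcd[cm,cn] G u M ⟨
          G * gcd u M                 ≡⟨ cong (G *_) (C.coprime⇒gcd≡1 cop) ⟩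
          G * 1                       ≡⟨ *-identityʳ G ⟩
          G                           ∎
          where open ≡-Reasoning

    block-distinct : AllPairs _≢_ (block G)
    block-distinct = AllPairs.map⁺ (AllPairs.map distinct
      (AllPairs-zip-All units-bounded-coprime (AllPairs.filter⁺ (λ u → coprime? u M) (AllPairs.applyUpTo⁺₁ id M (λ i<j _ → i<j)))))
      where
      distinct : ∀ {u v} → (u < M × Coprime u M) × (v < M × Coprime v M) × u < v → (G * u) mod N ≢ (G * v) mod N
      distinct {u} {v} ((u<M , _) , (v<M , _) , u<v) same = <-irrefl
        (*-cancelˡ-≡ u v G (trans (sym (toℕ-mod-block u<M)) (trans (cong toℕ same) (toℕ-mod-block v<M))))
        u<v

    block-adjacent : AllPairs (PowerAdj N) (block G)
    block-adjacent = AllPairs.map (λ (gx , gy , x≢y) → generators-adjacent gx gy ∣-refl x≢y)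
      (AllPairs-zip-All block-generates block-distinct)

  blocks-adjacent : ∀ {G G′} → G ∣ N → G′ ∣ N → G ∣ G′ → G ≢ G′ → All (λ x → All (PowerAdj N x) (block G′)) (block G)
  blocks-adjacent G∣N G′∣N G∣G′ G≢G′ = All.map (λ gx → All.map (λ gy →
      generators-adjacent gx gy G∣G′ (λ x≡y → G≢G′ (trans (sym (proj₁ gx)) (trans (cong (λ z → gcd (toℕ z) N) x≡y) (proj₁ gy)))))
      (block-generates G′∣N))
    (block-generates G∣N)

  clique : List (Fin N)
  clique = concat (map (block ∘ product) (inits ps))

  clique-adjacent : AllPairs (PowerAdj N) clique
  clique-adjacent = AllPairs.concat⁺
    (All.map⁺ (All.map block-adjacent (inits-∣ ps)))
    (AllPairs.map⁺ (AllPairs.map (λ (p∣N , q∣N , p∣q , p≢q) → blocks-adjacent p∣N q∣N p∣q p≢q)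
      (AllPairs-zip-All (inits-∣ ps) (inits-strictly-∣ pps))))

  length-clique : length clique ≡ sum (map (λ p → φ (N /′ product p)) (inits ps))
  length-clique = trans (length-concat (map (block ∘ product) (inits ps)))
    (cong sum (trans (sym (map-∘ (inits ps))) (map-cong (length-block ∘ product) (inits ps))))

  colours-≥-clique : ∀ c → Colourable N c → length clique ≤ c
  colours-≥-clique c (f , proper) = AllPairs-≢⇒length≤ f (AllPairs.map (λ {x} {y} → proper x y) clique-adjacent)

  colours-≥ : ∀ c → Colourable N c → sum (map (λ p → φ (N /′ product p)) (inits ps)) ≤ c
  colours-≥ c colourable = subst (_≤ c) length-clique (colours-≥-clique c colourable)

corollary7 : (n : ℕ) .{{_ : NonZero n}} (ds : List ℕ) →
    All Prime ds → Sorted ds → product ds ≡ n →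
    ChromaticNumber n (sum (map (λ p → φ (n /′ product p)) (inits ds)))
corollary7 _ ds pds sorted refl = Colouring.colourable ds pds sorted , Clique.colours-≥ ds pds
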